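{- Let $G$ be a simple graph, $k\ge1$, and let $\overrightarrow{G}^{(k)}$ be obtained from $G$ by the construction described in the context. If an oriented graph $\overrightarrow{H}^{(k)}$ is push equivalent to $\overrightarrow{G}^{(k)}$, then $\overrightarrow{H}^{(k)}$ can also be obtained from $G$ by that construction.
   Context: Construction: given a simple graph $G$ and $k\ge1$, an oriented graph $\overrightarrow{G}^{(k)}$ is obtained by keeping the vertices of $G$ and replacing each edge $uv$ of $G$ by two internally disjoint oriented paths $\overrightarrow{P}$ and $\overrightarrow{P'}$ between $u$ and $v$, each of length $4k$ with new internal vertices, such that, traversing from $u$ to $v$, the number of forward arcs (arcs oriented in the traversal direction) is even in $\overrightarrow{P}$ and odd in $\overrightarrow{P'}$. To push a vertex is to reverse all arcs incident to it; pushing a set pushes each vertex once; push equivalent means obtainable from each other by pushing a vertex set. -}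

module Defs where

open import Data.Nat using (ℕ; zero; suc; _+_; _*_; _∸_; _<_; _≤_; _<?_)
open import Data.Nat.Properties using (∸-monoˡ-≤)
open import Data.Nat.Divisibility using (_∣_)
open import Data.Fin using (Fin; toℕ; fromℕ<)
open import Data.Bool using (Bool; true; false)
open import Data.Product using (Σ; ∃; _×_; _,_; proj₁; proj₂)
open import Data.Sum using (_⊎_; inj₁; inj₂)
open import Relation.Nullary using (¬_; yes; no)
open import Relation.Binary.PropositionalEquality using (_≡_; _≢_)
open import Function.Bundles using (_⇔_)

-- Finite simple graphs on vertex set Fin n, given by an edge list
-- ends : Fin m → Fin n × Fin n  (each edge uv stored as an ordered pair,
-- the order only fixes the traversal direction "from u to v").

record SimpleGraph (n : ℕ) : Set where
  field
    m        : ℕ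
    ends     : Fin m → Fin n × Fin n
    loopless : ∀ e → proj₁ (ends e) ≢ proj₂ (ends e)
    noMulti  : ∀ e e' → e ≢ e' →
               ¬ ((proj₁ (ends e) ≡ proj₁ (ends e') × proj₂ (ends e) ≡ proj₂ (ends e'))
                ⊎ (proj₁ (ends e) ≡ proj₂ (ends e') × proj₂ (ends e) ≡ proj₁ (ends e')))

OrientedGraph : Set → Set₁
OrientedGraph V = V → V → Set

-- Pushing a set S (given by its indicator S : V → Bool): every vertex of S
-- is pushed once, so an arc is reversed iff exactly one endpoint is in S.
push : {V : Set} → (V → Bool) → OrientedGraph V → OrientedGraph V
push S D x y = (S x ≡ S y × D x y) ⊎ (S x ≢ S y × D y x)

_≅_ : {V : Set} → OrientedGraph V → OrientedGraph V → Set
D ≅ D' = ∀ x y → D x y ⇔ D' x y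

PushEquivalent : {V : Set} → OrientedGraph V → OrientedGraph V → Set
PushEquivalent D D' = ∃ λ (S : _ → Bool) → push S D ≅ D'

module Construction {n : ℕ} (G : SimpleGraph n) (k : ℕ) where
  open SimpleGraph G

  L : ℕ
  L = 4 * k          -- length of each path

  -- vertices: the original ones, plus for each edge e, each of the two
  -- paths j ∈ Fin 2 (j = 0 is P, j = 1 is P'), the 4k-1 internal vertices.
  V : Set
  V = Fin n ⊎ (Fin m × Fin 2 × Fin (L ∸ 1))

  -- the vertex at position p (0 ≤ p ≤ 4k) along path j of edge e,
  -- traversed from u = proj₁ (ends e) to v = proj₂ (ends e).
  pos : Fin m → Fin 2 → ℕ → V
  pos e j zero = inj₁ (proj₁ (ends e))
  pos e j (suc p) with suc p <? L
  ... | yes lt = inj₂ (e , j , fromℕ< (∸-monoˡ-≤ 1 lt))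
  ... | no  _  = inj₁ (proj₂ (ends e))

  -- an orientation of the paths: o e j i = true iff the i-th arc of path j
  -- of edge e (between positions i and i+1) is forward (towards v).
  Orientation : Set
  Orientation = Fin m → Fin 2 → Fin L → Bool

  arcs : Orientation → OrientedGraph V
  arcs o x y = ∃ λ e → ∃ λ j → ∃ λ (i : Fin L) →
      (o e j i ≡ true  × pos e j (toℕ i) ≡ x × pos e j (suc (toℕ i)) ≡ y)
    ⊎ (o e j i ≡ false × pos e j (suc (toℕ i)) ≡ x × pos e j (toℕ i) ≡ y)

  countTrue : (l : ℕ) → (Fin l → Bool) → ℕ
  countTrue zero    f = 0
  countTrue (suc l) f with f Fin.zero
  ... | true  = suc (countTrue l (λ i → f (Fin.suc i)))
  ... | false = countTrue l (λ i → f (Fin.suc i))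

  forward : Orientation → Fin m → Fin 2 → ℕ
  forward o e j = countTrue L (o e j)

  -- D is obtainable from G by the construction (on this vertex set),
  -- where the roles of the two paths P, P' of an edge may be exchanged.
  Obtainable : OrientedGraph V → Set
  Obtainable D = ∃ λ (o : Orientation) →
    (∀ e → (2 ∣ forward o e Fin.zero × ¬ (2 ∣ forward o e (Fin.suc Fin.zero)))
         ⊎ (¬ (2 ∣ forward o e Fin.zero) × 2 ∣ forward o e (Fin.suc Fin.zero)))
    × arcs o ≅ D

-- Pushing a set S reverses exactly the arcs with one end in S, so pushing the
-- construction of G yields the same construction with the orientation of every
-- arc xor-ed by S(tail) xor S(head). Along a path from u to v these flips
-- telescope: the parity of the number of forward arcs changes by S(u) xor S(v),
-- the same amount on both paths of an edge. Hence exactly one of the two paths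
-- still has an even number of forward arcs.
module Submission where

open import Defs
open import Algebra.Bundles using (CommutativeRing)
open import Data.Bool using (Bool; true; false; not; _xor_)
open import Data.Bool.Properties
  using (_≟_; xor-assoc; xor-comm; xor-same; xor-identityʳ; xor-inverseˡ;
         not-involutive; not-injective; ¬-not; xor-∧-commutativeRing)
open import Algebra.Properties.CommutativeSemigroup
  (CommutativeRing.+-commutativeSemigroup xor-∧-commutativeRing) using (interchange)
open import Data.Fin using (Fin; toℕ)
open import Data.Nat using (ℕ; zero; suc; _*_; _≤_; s≤s; _<?_)
open import Data.Nat.Properties using (<-irrefl)
open import Data.Nat.Divisibility using (_∣_; divides)
open import Data.Product using (_×_; _,_; proj₁; proj₂)
open import Data.Sum using (_⊎_; inj₁; inj₂)
open import Function using (_∘_)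
open import Function.Bundles using (_⇔_; mk⇔; Equivalence)
import Function.Properties.Equivalence as ⇔
open import Relation.Nullary using (¬_; yes; no; contradiction)
open import Relation.Binary.PropositionalEquality

xor-xor-cancelʳ : ∀ p c → (p xor c) xor c ≡ p
xor-xor-cancelʳ p c = begin
  (p xor c) xor c  ≡⟨ xor-assoc p c c ⟩
  p xor (c xor c)  ≡⟨ cong (p xor_) (xor-same c) ⟩
  p xor false      ≡⟨ xor-identityʳ p ⟩
  p                ∎
  where open ≡-Reasoning

xor-cancelʳ : ∀ {p q} c → p xor c ≡ q xor c → p ≡ q
xor-cancelʳ {p} {q} c eq =
  trans (sym (xor-xor-cancelʳ p c)) (trans (cong (_xor c) eq) (xor-xor-cancelʳ q c))

xor-telescope : ∀ a b c → (a xor b) xor (b xor c) ≡ a xor c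
xor-telescope a b c = begin
  (a xor b) xor (b xor c)  ≡⟨ xor-assoc a b (b xor c) ⟩
  a xor (b xor (b xor c))  ≡⟨ cong (a xor_) (sym (xor-assoc b b c)) ⟩
  a xor ((b xor b) xor c)  ≡⟨ cong (λ z → a xor (z xor c)) (xor-same b) ⟩
  a xor c                  ∎
  where open ≡-Reasoning

xor-agree : ∀ t {p q} → p ≡ q → t xor (p xor q) ≡ t
xor-agree t {p} refl = trans (cong (t xor_) (xor-same p)) (xor-identityʳ t)

xor-differ : ∀ t {p q} → p ≢ q → t xor (p xor q) ≡ not t
xor-differ t {p} {q} p≢q = begin
  t xor (p xor q)      ≡⟨ cong (λ z → t xor (z xor q)) (¬-not p≢q) ⟩
  t xor (not q xor q)  ≡⟨ cong (t xor_) (xor-inverseˡ q) ⟩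
  t xor true           ≡⟨ xor-comm t true ⟩
  not t                ∎
  where open ≡-Reasoning

isOdd : ℕ → Bool
isOdd zero    = false
isOdd (suc n) = not (isOdd n)

isOdd-*2 : ∀ q → isOdd (q * 2) ≡ false
isOdd-*2 zero    = refl
isOdd-*2 (suc q) = trans (not-involutive _) (isOdd-*2 q)

2∣⇒¬isOdd : ∀ {n} → 2 ∣ n → isOdd n ≡ false
2∣⇒¬isOdd (divides q refl) = isOdd-*2 q

¬isOdd⇒2∣ : ∀ n → isOdd n ≡ false → 2 ∣ n
¬isOdd⇒2∣ zero          _ = divides 0 refl
¬isOdd⇒2∣ (suc (suc n)) h with ¬isOdd⇒2∣ n (trans (sym (not-involutive _)) h)
... | divides q refl = divides (suc q) refl

ExactlyOneEven : ℕ → ℕ → Set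
ExactlyOneEven a b = (2 ∣ a × ¬ 2 ∣ b) ⊎ (¬ 2 ∣ a × 2 ∣ b)

exactlyOneEven⇒isOdd≢ : ∀ {a b} → ExactlyOneEven a b → isOdd a ≢ isOdd b
exactlyOneEven⇒isOdd≢ {b = b} (inj₁ (2∣a , 2∤b)) eq =
  2∤b (¬isOdd⇒2∣ b (trans (sym eq) (2∣⇒¬isOdd 2∣a)))
exactlyOneEven⇒isOdd≢ {a = a} (inj₂ (2∤a , 2∣b)) eq =
  2∤a (¬isOdd⇒2∣ a (trans eq (2∣⇒¬isOdd 2∣b)))

isOdd≢⇒exactlyOneEven : ∀ a b → isOdd a ≢ isOdd b → ExactlyOneEven a b
isOdd≢⇒exactlyOneEven a b a≢b with isOdd a in pa | isOdd b in pb
... | false | false = contradiction refl a≢b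
... | false | true  = inj₁ (¬isOdd⇒2∣ a pa , λ 2∣b → a≢b (sym (trans (sym pb) (2∣⇒¬isOdd 2∣b))))
... | true  | false = inj₂ ((λ 2∣a → a≢b (trans (sym pa) (2∣⇒¬isOdd 2∣a))) , ¬isOdd⇒2∣ b pb)
... | true  | true  = contradiction refl a≢b

exactlyOneEven-xor : ∀ {a b a' b'} c →
  isOdd a' ≡ isOdd a xor c → isOdd b' ≡ isOdd b xor c →
  ExactlyOneEven a b → ExactlyOneEven a' b'
exactlyOneEven-xor {a' = a'} {b'} c pa pb ab = isOdd≢⇒exactlyOneEven a' b' λ eq →
  exactlyOneEven⇒isOdd≢ ab (xor-cancelʳ c (trans (sym pa) (trans eq pb)))

module _ {V : Set} where

  ≅-trans : {D D' D'' : OrientedGraph V} → D ≅ D' → D' ≅ D'' → D ≅ D''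
  ≅-trans p q x y = ⇔.trans (p x y) (q x y)

  ≅-sym : {D D' : OrientedGraph V} → D ≅ D' → D' ≅ D
  ≅-sym p x y = ⇔.sym (p x y)

  push-mono : ∀ S {D D' : OrientedGraph V} → (∀ x y → D x y → D' x y) →
              ∀ x y → push S D x y → push S D' x y
  push-mono S f x y (inj₁ (s , a)) = inj₁ (s , f x y a)
  push-mono S f x y (inj₂ (s , a)) = inj₂ (s , f y x a)

  push-resp-≅ : ∀ S {D D' : OrientedGraph V} → D ≅ D' → push S D ≅ push S D'
  push-resp-≅ S D≅D' x y = mk⇔
    (push-mono S (λ u v → Equivalence.to (D≅D' u v)) x y)
    (push-mono S (λ u v → Equivalence.from (D≅D' u v)) x y)

  -- arcs o is, definitionally, the union of Arc (o e j i) (pos e j i) (pos e j (i + 1)).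
  Arc : Bool → V → V → OrientedGraph V
  Arc t a b x y = (t ≡ true × a ≡ x × b ≡ y) ⊎ (t ≡ false × b ≡ x × a ≡ y)

  push-Arc : ∀ S t a b → push S (Arc t a b) ≅ Arc (t xor (S a xor S b)) a b
  push-Arc S t a b x y = mk⇔ to from
    where
    to : push S (Arc t a b) x y → Arc (t xor (S a xor S b)) a b x y
    to (inj₁ (s , inj₁ (t≡1 , refl , refl))) = inj₁ (trans (xor-agree t s) t≡1 , refl , refl)
    to (inj₁ (s , inj₂ (t≡0 , refl , refl))) = inj₂ (trans (xor-agree t (sym s)) t≡0 , refl , refl)
    to (inj₂ (s , inj₁ (t≡1 , refl , refl))) =
      inj₂ (trans (xor-differ t (s ∘ sym)) (cong not t≡1) , refl , refl)
    to (inj₂ (s , inj₂ (t≡0 , refl , refl))) =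
      inj₁ (trans (xor-differ t s) (cong not t≡0) , refl , refl)

    from : Arc (t xor (S a xor S b)) a b x y → push S (Arc t a b) x y
    from (inj₁ (h , refl , refl)) with S a ≟ S b
    ... | yes s = inj₁ (s , inj₁ (trans (sym (xor-agree t s)) h , refl , refl))
    ... | no  s = inj₂ (s , inj₂ (not-injective (trans (sym (xor-differ t s)) h) , refl , refl))
    from (inj₂ (h , refl , refl)) with S b ≟ S a
    ... | yes s = inj₁ (s , inj₂ (trans (sym (xor-agree t (sym s))) h , refl , refl))
    ... | no  s =
      inj₂ (s , inj₁ (not-injective (trans (sym (xor-differ t (s ∘ sym))) h) , refl , refl))

module PushedConstruction {n : ℕ} (G : SimpleGraph n) (k : ℕ) where
  open SimpleGraph G
  open Construction G k

  pushOrientation : (V → Bool) → Orientation → Orientation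
  pushOrientation S o e j i = o e j i xor (S (pos e j (toℕ i)) xor S (pos e j (suc (toℕ i))))

  push-arcs : ∀ S o → push S (arcs o) ≅ arcs (pushOrientation S o)
  push-arcs S o x y = mk⇔ to from
    where
    arc : ∀ e j i → push S _ ≅ _
    arc e j i = push-Arc S (o e j i) (pos e j (toℕ i)) (pos e j (suc (toℕ i)))

    to : push S (arcs o) x y → arcs (pushOrientation S o) x y
    to (inj₁ (s , e , j , i , a)) = e , j , i , Equivalence.to (arc e j i x y) (inj₁ (s , a))
    to (inj₂ (s , e , j , i , a)) = e , j , i , Equivalence.to (arc e j i x y) (inj₂ (s , a))

    from : arcs (pushOrientation S o) x y → push S (arcs o) x y
    from (e , j , i , a) with Equivalence.from (arc e j i x y) a
    ... | inj₁ (s , a') = inj₁ (s , e , j , i , a')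
    ... | inj₂ (s , a') = inj₂ (s , e , j , i , a')

  isOdd-countTrue-suc : ∀ l (f : Fin (suc l) → Bool) →
    isOdd (countTrue (suc l) f) ≡ f Fin.zero xor isOdd (countTrue l (f ∘ Fin.suc))
  isOdd-countTrue-suc l f with f Fin.zero
  ... | true  = refl
  ... | false = refl

  isOdd-countTrue-xor : ∀ l (f g : Fin l → Bool) →
    isOdd (countTrue l (λ i → f i xor g i)) ≡ isOdd (countTrue l f) xor isOdd (countTrue l g)
  isOdd-countTrue-xor zero    f g = refl
  isOdd-countTrue-xor (suc l) f g = begin
    isOdd (countTrue (suc l) (λ i → f i xor g i))
      ≡⟨ isOdd-countTrue-suc l (λ i → f i xor g i) ⟩
    (f₀ xor g₀) xor isOdd (countTrue l (λ i → f (Fin.suc i) xor g (Fin.suc i)))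
      ≡⟨ cong ((f₀ xor g₀) xor_) (isOdd-countTrue-xor l (f ∘ Fin.suc) (g ∘ Fin.suc)) ⟩
    (f₀ xor g₀) xor (isOdd (countTrue l (f ∘ Fin.suc)) xor isOdd (countTrue l (g ∘ Fin.suc)))
      ≡⟨ interchange f₀ g₀ _ _ ⟩
    (f₀ xor isOdd (countTrue l (f ∘ Fin.suc))) xor (g₀ xor isOdd (countTrue l (g ∘ Fin.suc)))
      ≡⟨ sym (cong₂ _xor_ (isOdd-countTrue-suc l f) (isOdd-countTrue-suc l g)) ⟩
    isOdd (countTrue (suc l) f) xor isOdd (countTrue (suc l) g)
      ∎
    where
    open ≡-Reasoning
    f₀ = f Fin.zero
    g₀ = g Fin.zero

  isOdd-countTrue-telescope : ∀ l (h : ℕ → Bool) →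
    isOdd (countTrue l (λ i → h (toℕ i) xor h (suc (toℕ i)))) ≡ h 0 xor h l
  isOdd-countTrue-telescope zero    h = sym (xor-same (h 0))
  isOdd-countTrue-telescope (suc l) h = begin
    isOdd (countTrue (suc l) (λ i → h (toℕ i) xor h (suc (toℕ i))))
      ≡⟨ isOdd-countTrue-suc l (λ i → h (toℕ i) xor h (suc (toℕ i))) ⟩
    (h 0 xor h 1) xor isOdd (countTrue l (λ i → h (suc (toℕ i)) xor h (suc (suc (toℕ i)))))
      ≡⟨ cong ((h 0 xor h 1) xor_) (isOdd-countTrue-telescope l (h ∘ suc)) ⟩
    (h 0 xor h 1) xor (h 1 xor h (suc l))
      ≡⟨ xor-telescope (h 0) (h 1) (h (suc l)) ⟩
    h 0 xor h (suc l)
      ∎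
    where open ≡-Reasoning

  pos-last : ∀ e j p → suc p ≡ L → pos e j (suc p) ≡ inj₁ (proj₂ (ends e))
  pos-last e j p 1+p≡L with suc p <? L
  ... | yes 1+p<L = contradiction 1+p<L (<-irrefl 1+p≡L)
  ... | no  _     = refl

  pos-end : 1 ≤ k → ∀ e j → pos e j L ≡ inj₁ (proj₂ (ends e))
  pos-end (s≤s _) e j = pos-last e j _ refl

  isOdd-forward-push : 1 ≤ k → ∀ S o e j →
    isOdd (forward (pushOrientation S o) e j)
      ≡ isOdd (forward o e j) xor (S (inj₁ (proj₁ (ends e))) xor S (inj₁ (proj₂ (ends e))))
  isOdd-forward-push 1≤k S o e j = begin
    isOdd (forward (pushOrientation S o) e j)
      ≡⟨ isOdd-countTrue-xor L (o e j) flips ⟩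
    isOdd (forward o e j) xor isOdd (countTrue L flips)
      ≡⟨ cong (isOdd (forward o e j) xor_) (isOdd-countTrue-telescope L (S ∘ pos e j)) ⟩
    isOdd (forward o e j) xor (S (pos e j 0) xor S (pos e j L))
      ≡⟨ cong (λ w → isOdd (forward o e j) xor (S (pos e j 0) xor S w)) (pos-end 1≤k e j) ⟩
    isOdd (forward o e j) xor (S (inj₁ (proj₁ (ends e))) xor S (inj₁ (proj₂ (ends e))))
      ∎
    where
    open ≡-Reasoning
    flips : Fin L → Bool
    flips i = S (pos e j (toℕ i)) xor S (pos e j (suc (toℕ i)))

  pushOrientation-exactlyOneEven : 1 ≤ k → ∀ S o e →
    ExactlyOneEven (forward o e Fin.zero) (forward o e (Fin.suc Fin.zero)) →
    ExactlyOneEven (forward (pushOrientation S o) e Fin.zero)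
                   (forward (pushOrientation S o) e (Fin.suc Fin.zero))
  pushOrientation-exactlyOneEven 1≤k S o e =
    exactlyOneEven-xor _ (isOdd-forward-push 1≤k S o e Fin.zero)
                         (isOdd-forward-push 1≤k S o e (Fin.suc Fin.zero))

mainTheorem12 : ∀ {n} (G : SimpleGraph n) (k : ℕ) → 1 ≤ k →
    let open Construction G k in
    (D H : OrientedGraph V) → Obtainable D → PushEquivalent D H →
    Obtainable H
mainTheorem12 G k 1≤k D H (o , exactlyOneEven , arcs≅D) (S , pushD≅H) =
    pushOrientation S o
  , (λ e → pushOrientation-exactlyOneEven 1≤k S o e (exactlyOneEven e))
  , ≅-trans (≅-sym (push-arcs S o)) (≅-trans (push-resp-≅ S arcs≅D) pushD≅H)
  where open PushedConstruction G k
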